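{- Let $\sigma$ be a D-permutation of $[2n]$ and let $u_1,\dots,u_{2n}$ be the listing $2,4,\dots,2n,2n-1,2n-3,\dots,3,1$ of $[2n]$. Call a non-fixed point $u_j$ of $\sigma$ a cycle closer if, in the digraph $L|_{\{u_1,\dots,u_{j-1}\}}$, $u_j$ and $\sigma(u_j)$ are respectively the final and initial vertices of one and the same directed path, so that inserting the edge $u_j\to\sigma(u_j)$ turns this path into a cycle. Then an element $u\in[2n]$ is a cycle closer if and only if it is a cycle valley minimum, i.e. a cycle valley of $\sigma$ that is the smallest element of its cycle.
   Context: A D-permutation of $[2n]$ is a permutation $\sigma$ with $\sigma(2k-1)\ge2k-1$ and $\sigma(2k)\le2k$ for all $k$. For $S\subseteq[2n]$, $L|_S$ is the directed graph on vertex set $[2n]$ with edges $u\to\sigma(u)$ for $u\in S$. A cycle valley is an index $i$ with $\sigma^{ -1}(i)>i<\sigma(i)$. -}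

module Defs where

open import Data.Nat using (ℕ; zero; suc; _*_; _+_; _≤_; _<_; _≟_)
open import Data.Fin using (Fin; toℕ)
open import Data.Fin.Permutation using (Permutation′; _⟨$⟩ʳ_; _⟨$⟩ˡ_)
open import Data.List using (List; map; upTo; reverse; takeWhile; _++_)
open import Data.List.Membership.Propositional using (_∈_)
open import Data.Product using (_×_; Σ; ∃)
open import Relation.Binary.PropositionalEquality using (_≡_; _≢_)
open import Relation.Nullary using (¬?)

-- Elements of [2n] are represented by Fin (2 * n); the element i : Fin (2 * n)
-- stands for the integer  lab i = toℕ i + 1 ∈ {1, …, 2n}.
lab : ∀ {m} → Fin m → ℕ
lab i = suc (toℕ i)

IsDPerm : ∀ n → Permutation′ (2 * n) → Set
IsDPerm n σ = ∀ (i : Fin (2 * n)) (k : ℕ) →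
  (lab i ≡ suc (2 * k) → lab i ≤ lab (σ ⟨$⟩ʳ i)) ×
  (lab i ≡ 2 * suc k → lab (σ ⟨$⟩ʳ i) ≤ lab i)

iter : ∀ {m} → Permutation′ m → ℕ → Fin m → Fin m
iter σ zero    x = x
iter σ (suc k) x = σ ⟨$⟩ʳ (iter σ k x)

listing : ℕ → List ℕ
listing n = map (λ k → 2 * suc k) (upTo n) ++ map (λ k → suc (2 * k)) (reverse (upTo n))

-- v ∈ {u₁, …, u_{j-1}} where u = u_j : v occurs in the listing strictly before u.
Before : ∀ n → Fin (2 * n) → Fin (2 * n) → Set
Before n u v = lab v ∈ takeWhile (λ x → ¬? (x ≟ lab u)) (listing n)

-- A directed path in the digraph L|_S (edges x → σ(x) for x ∈ S) from a to b:
-- vertices a = x₀ → x₁ → … → x_k = b, with x_{i+1} = σ(x_i), every x_i (i < k) in S,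
-- and all vertices pairwise distinct.
PathIn : ∀ {m} → Permutation′ m → (Fin m → Set) → Fin m → Fin m → Set
PathIn σ S a b = Σ ℕ λ k →
  (iter σ k a ≡ b) ×
  (∀ i → i < k → S (iter σ i a)) ×
  (∀ i j → i ≤ k → j ≤ k → i ≢ j → iter σ i a ≢ iter σ j a)

CycleCloser : ∀ n → Permutation′ (2 * n) → Fin (2 * n) → Set
CycleCloser n σ u = (σ ⟨$⟩ʳ u ≢ u) × PathIn σ (Before n u) (σ ⟨$⟩ʳ u) u

CycleValley : ∀ {m} → Permutation′ m → Fin m → Set
CycleValley σ i = (toℕ i < toℕ (σ ⟨$⟩ˡ i)) × (toℕ i < toℕ (σ ⟨$⟩ʳ i))

CycleValleyMin : ∀ {m} → Permutation′ m → Fin m → Set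
CycleValleyMin σ i = CycleValley σ i × (∀ k → toℕ i ≤ toℕ (iter σ k i))

-- In the listing u₁, …, u_{2n} the predecessors of an even u are even, and the
-- predecessors of an odd u are the evens together with the odds above u.
-- A D-permutation moves even points weakly down.  If u closes a cycle, its
-- whole cycle lies in {u} ∪ {predecessors of u}.  For even u the cycle is
-- all even, so σ only descends along it and returning to u forces σ(u) = u.
-- For odd u, a point of the cycle below u would be even, so the cycle could
-- never climb back to u: hence u is the minimum of its cycle, and a cycle
-- valley.  Conversely a cycle valley u has σ(u) > u, so u is odd, and if u is
-- the minimum of its cycle, every other point of the cycle lies above u and
-- thus precedes u; the cycle minus the edge u → σ(u) is the required path.
module Submission where

open import Defs
open import Data.Nat using (ℕ; zero; suc; _*_; _+_; _∸_; _≤_; _<_; _>_; _≟_; s≤s; z≤n)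
open import Data.Nat.Properties
open import Data.Fin using (Fin; toℕ)
import Data.Fin as Fin
open import Data.Fin.Properties using (toℕ-injective; toℕ<n; pigeonhole)
open import Data.Fin.Permutation using (Permutation′; _⟨$⟩ʳ_; _⟨$⟩ˡ_; inverseˡ)
open import Data.List using (List; _∷_; _++_; map; upTo; reverse; downFrom; takeWhile)
open import Data.List.Properties using (reverse-upTo)
open import Data.List.Membership.Propositional using (_∈_)
open import Data.List.Membership.Propositional.Properties
  using (∈-map⁺; ∈-map⁻; ∈-++⁺ˡ; ∈-++⁺ʳ; ∈-++⁻; ∈-upTo⁺; ∈-downFrom⁺)
open import Data.List.Relation.Unary.Any as Any using (Any; here; there)
open import Data.List.Relation.Unary.All as All using (All; []; _∷_)
open import Data.List.Relation.Unary.AllPairs using (AllPairs; []; _∷_)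
import Data.List.Relation.Unary.AllPairs.Properties as AllPairs
open import Data.Product using (∃; _×_; _,_; proj₂)
open import Data.Sum using (_⊎_; inj₁; inj₂; [_,_])
open import Data.Empty using (⊥-elim)
open import Function using (_∘_; id)
open import Function.Bundles using (_⇔_; mk⇔)
open import Relation.Binary.Definitions using (tri<; tri≈; tri>)
open import Relation.Binary.PropositionalEquality
  using (_≡_; _≢_; refl; sym; trans; cong; subst; module ≡-Reasoning)
open import Relation.Nullary using (¬_; yes; no; ¬?)
open import Relation.Nullary.Decidable using (dec-false)
open import Relation.Unary using (Decidable; ∁)

least-witness : ∀ {p} {P : ℕ → Set p} → Decidable P → ∀ {k} → P k →
  ∃ λ q → P q × (∀ r → r < q → ¬ P r)
least-witness {P = P} P? {k} Pk = search (suc k) ≤-refl Pk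
  where
  search : ∀ b {m} → m < b → P m → ∃ λ q → P q × (∀ r → r < q → ¬ P r)
  search (suc b) {m} m<b Pm with anyUpTo? P? m
  ... | yes (r , r<m , Pr) = search b (<-≤-trans r<m (≤-pred m<b)) Pr
  ... | no none            = m , Pm , λ r r<m Pr → none (r , r<m , Pr)

module _ {a p} {A : Set a} {P : A → Set p} (P? : Decidable P) where

  ∈-takeWhile⁻ : ∀ {x xs} → x ∈ takeWhile P? xs → x ∈ xs
  ∈-takeWhile⁻ {xs = y ∷ ys} x∈ with P? y | x∈
  ... | yes _ | here x≡y   = here x≡y
  ... | yes _ | there x∈ys = there (∈-takeWhile⁻ x∈ys)

  takeWhile-++-all : ∀ {xs} ys → All P xs → takeWhile P? (xs ++ ys) ≡ xs ++ takeWhile P? ys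
  takeWhile-++-all ys [] = refl
  takeWhile-++-all {x ∷ xs} ys (px ∷ pxs) with P? x
  ... | yes _  = cong (x ∷_) (takeWhile-++-all ys pxs)
  ... | no ¬px = ⊥-elim (¬px px)

  takeWhile-++-any : ∀ {xs} ys → Any (∁ P) xs → takeWhile P? (xs ++ ys) ≡ takeWhile P? xs
  takeWhile-++-any {x ∷ xs} ys (here ¬px) rewrite dec-false (P? x) ¬px = refl
  takeWhile-++-any {x ∷ xs} ys (there ¬P∈xs) with P? x
  ... | yes _ = cong (x ∷_) (takeWhile-++-any ys ¬P∈xs)
  ... | no _  = refl

Descending : List ℕ → Set
Descending = AllPairs _>_

module _ {p} {P : ℕ → Set p} (P? : Decidable P) {y : ℕ} where

  ∈-takeWhile-descending⁻ : ∀ {x xs} → Descending xs → y ∈ xs → ¬ P y →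
    x ∈ takeWhile P? xs → y < x
  ∈-takeWhile-descending⁻ {xs = z ∷ zs} (z>zs ∷ desc) y∈ ¬Py x∈ with P? z | x∈ | y∈
  ... | yes Pz | _          | here refl  = ⊥-elim (¬Py Pz)
  ... | yes _  | here refl  | there y∈zs = All.lookup z>zs y∈zs
  ... | yes _  | there x∈zs | there y∈zs = ∈-takeWhile-descending⁻ desc y∈zs ¬Py x∈zs

  ∈-takeWhile-descending⁺ : ∀ {x xs} → (∀ z → y < z → P z) → Descending xs → x ∈ xs →
    y < x → x ∈ takeWhile P? xs
  ∈-takeWhile-descending⁺ {xs = z ∷ zs} above (z>zs ∷ desc) x∈ y<x with P? z | x∈
  ... | no ¬Pz | here refl  = ⊥-elim (¬Pz (above z y<x))
  ... | no ¬Pz | there x∈zs = ⊥-elim (¬Pz (above z (<-trans y<x (All.lookup z>zs x∈zs))))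
  ... | yes _  | here refl  = here refl
  ... | yes _  | there x∈zs = there (∈-takeWhile-descending⁺ above desc x∈zs y<x)

evens odds : ℕ → List ℕ
evens n = map (λ k → 2 * suc k) (upTo n)
odds n = map (λ k → suc (2 * k)) (reverse (upTo n))

odds≡map-downFrom : ∀ n → odds n ≡ map (λ k → suc (2 * k)) (downFrom n)
odds≡map-downFrom n = cong (map (λ k → suc (2 * k))) (reverse-upTo n)

∈-evens : ∀ {n c} → c < n → 2 * suc c ∈ evens n
∈-evens c<n = ∈-map⁺ _ (∈-upTo⁺ c<n)

∈-odds : ∀ {n c} → c < n → suc (2 * c) ∈ odds n
∈-odds {n} c<n = subst (_ ∈_) (sym (odds≡map-downFrom n)) (∈-map⁺ _ (∈-downFrom⁺ c<n))

odds-descending : ∀ n → Descending (odds n)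
odds-descending n = subst Descending (sym (odds≡map-downFrom n))
  (AllPairs.map⁺ (AllPairs.applyDownFrom⁺₁ id n (λ j<i _ → s≤s (*-monoʳ-< 2 j<i))))

∈-evens⁻ : ∀ {n z} → z ∈ evens n → ∃ λ c → z ≡ 2 * suc c
∈-evens⁻ z∈ with ∈-map⁻ (λ k → 2 * suc k) z∈
... | c , _ , z≡ = c , z≡

evens≢odd : ∀ {n z} c → z ∈ evens n → z ≢ suc (2 * c)
evens≢odd {n} c z∈ with ∈-evens⁻ {n} z∈
... | c′ , refl = even≢odd (suc c′) c

Even Odd : ∀ {m} → Fin m → Set
Even i = ∃ λ c → lab i ≡ 2 * suc c
Odd i = ∃ λ c → lab i ≡ suc (2 * c)

even⊎odd : ∀ {m} (i : Fin m) → Even i ⊎ Odd i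
even⊎odd i = parity (toℕ i)
  where
  parity : ∀ k → (∃ λ c → suc k ≡ 2 * suc c) ⊎ (∃ λ c → suc k ≡ suc (2 * c))
  parity zero = inj₂ (0 , refl)
  parity (suc k) with parity k
  ... | inj₁ (c , e) = inj₂ (suc c , cong suc e)
  ... | inj₂ (c , e) = inj₁ (c , trans (cong suc e) (sym (*-suc 2 c)))

module _ {n : ℕ} where

  even-bound : ∀ {i : Fin (2 * n)} {c} → lab i ≡ 2 * suc c → c < n
  even-bound {i} e = *-cancelˡ-≤ 2 (subst (_≤ 2 * n) e (toℕ<n i))

  odd-bound : ∀ {i : Fin (2 * n)} {c} → lab i ≡ suc (2 * c) → c < n
  odd-bound {i} e = *-cancelˡ-< 2 _ n (subst (_≤ 2 * n) e (toℕ<n i))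

  lab∈evens : ∀ {i : Fin (2 * n)} → Even i → lab i ∈ evens n
  lab∈evens {i} (c , e) = subst (_∈ evens n) (sym e) (∈-evens {n} {c} (even-bound {i} e))

  lab∈odds : ∀ {i : Fin (2 * n)} → Odd i → lab i ∈ odds n
  lab∈odds {i} (c , e) = subst (_∈ odds n) (sym e) (∈-odds {n} {c} (odd-bound {i} e))

  module _ {u : Fin (2 * n)} where

    private
      P? : Decidable (_≢ lab u)
      P? x = ¬? (x ≟ lab u)

    takeWhile-listing-odd : Odd u → takeWhile P? (listing n) ≡ evens n ++ takeWhile P? (odds n)
    takeWhile-listing-odd (c , ou) =
      takeWhile-++-all P? (odds n) (All.tabulate λ z∈ z≡u → evens≢odd {n} c z∈ (trans z≡u ou))

    before-even : ∀ {w} → Even u → Before n u w → Even w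
    before-even {w} eu w≺u =
      ∈-evens⁻ {n} (∈-takeWhile⁻ P? (subst (lab w ∈_) (takeWhile-++-any P? (odds n) u∈evens) w≺u))
      where
      u∈evens : Any (λ z → ¬ ¬ z ≡ lab u) (evens n)
      u∈evens = Any.map (λ u≡z z≢u → z≢u (sym u≡z)) (lab∈evens {u} eu)

    before-odd : ∀ {w} → Odd u → Before n u w → Even w ⊎ toℕ u < toℕ w
    before-odd {w} ou w≺u
      with ∈-++⁻ (evens n) (subst (lab w ∈_) (takeWhile-listing-odd ou) w≺u)
    ... | inj₁ w∈evens = inj₁ (∈-evens⁻ {n} w∈evens)
    ... | inj₂ w∈odds  = inj₂ (≤-pred (∈-takeWhile-descending⁻ P? (odds-descending n)
                                        (lab∈odds {u} ou) (λ u≢u → u≢u refl) w∈odds))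

    above-before-odd : ∀ {w} → Odd u → toℕ u < toℕ w → Before n u w
    above-before-odd {w} ou u<w =
      subst (lab w ∈_) (sym (takeWhile-listing-odd ou)) (by-parity (even⊎odd w))
      where
      by-parity : Even w ⊎ Odd w → lab w ∈ evens n ++ takeWhile P? (odds n)
      by-parity (inj₁ ew) = ∈-++⁺ˡ (lab∈evens {w} ew)
      by-parity (inj₂ ow) = ∈-++⁺ʳ (evens n)
        (∈-takeWhile-descending⁺ P? (λ z u<z z≡u → <-irrefl (sym z≡u) u<z) (odds-descending n)
          (lab∈odds {w} ow) (s≤s u<w))

module _ {m} (σ : Permutation′ m) where

  iter-suc : ∀ k x → iter σ k (σ ⟨$⟩ʳ x) ≡ iter σ (suc k) x
  iter-suc zero    x = refl
  iter-suc (suc k) x = cong (σ ⟨$⟩ʳ_) (iter-suc k x)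

  iter-+ : ∀ a b x → iter σ (a + b) x ≡ iter σ a (iter σ b x)
  iter-+ zero    b x = refl
  iter-+ (suc a) b x = cong (σ ⟨$⟩ʳ_) (iter-+ a b x)

  iter-injective : ∀ a {x y} → iter σ a x ≡ iter σ a y → x ≡ y
  iter-injective zero    eq = eq
  iter-injective (suc a) eq =
    iter-injective a (trans (sym (inverseˡ σ)) (trans (cong (σ ⟨$⟩ˡ_) eq) (inverseˡ σ)))

  iter-repeat⇒period : ∀ {i j x} → i < j → iter σ i x ≡ iter σ j x →
    ∃ λ o → i + o < j × iter σ (suc o) x ≡ x
  iter-repeat⇒period {i} {j} {x} i<j eq with m≤n⇒∃[o]m+o≡n i<j
  ... | o , i+1+o≡j = o , ≤-reflexive i+1+o≡j , sym (iter-injective i (begin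
    iter σ i x                   ≡⟨ eq ⟩
    iter σ j x                   ≡⟨ cong (λ s → iter σ s x) (trans (+-suc i o) i+1+o≡j) ⟨
    iter σ (i + suc o) x         ≡⟨ iter-+ i (suc o) x ⟩
    iter σ i (iter σ (suc o) x)  ∎))
    where open ≡-Reasoning

  periodic-reduce : ∀ k {x} → iter σ (suc k) x ≡ x → ∀ j → ∃ λ i → i ≤ k × iter σ j x ≡ iter σ i x
  periodic-reduce k per zero = 0 , z≤n , refl
  periodic-reduce k per (suc j) with periodic-reduce k per j
  ... | i , i≤k , eq with m≤n⇒m<n∨m≡n i≤k
  ... | inj₁ i<k  = suc i , i<k , cong (σ ⟨$⟩ʳ_) eq
  ... | inj₂ refl = 0 , z≤n , trans (cong (σ ⟨$⟩ʳ_) eq) per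

  periodic-return : ∀ k {x} → iter σ (suc k) x ≡ x → ∀ j → ∃ λ t → iter σ (t + j) x ≡ x
  periodic-return k {x} per j with periodic-reduce k per j
  ... | i , i≤k , eq = t , (begin
    iter σ (t + j) x        ≡⟨ iter-+ t j x ⟩
    iter σ t (iter σ j x)   ≡⟨ cong (iter σ t) eq ⟩
    iter σ t (iter σ i x)   ≡⟨ iter-+ t i x ⟨
    iter σ (t + i) x        ≡⟨ cong (λ s → iter σ s x) (m∸n+n≡m (m≤n⇒m≤1+n i≤k)) ⟩
    iter σ (suc k) x        ≡⟨ per ⟩
    x                       ∎)
    where
    open ≡-Reasoning
    t = suc k ∸ i

  periodic-invariant : ∀ {p} (P : Fin m → Set p) k {x} → iter σ (suc k) x ≡ x →
    (∀ j → P (iter σ j x) → P (iter σ (suc j) x)) → ∀ j → P (iter σ j x) → P x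
  periodic-invariant P k {x} per step j Pj with periodic-return k per j
  ... | t , back = subst P back (onward t)
    where
    onward : ∀ t → P (iter σ (t + j) x)
    onward zero    = Pj
    onward (suc t) = step (t + j) (onward t)

  has-period : ∀ x → ∃ λ k → iter σ (suc k) x ≡ x
  has-period x with pigeonhole (n<1+n m) (λ (i : Fin (suc m)) → iter σ (toℕ i) x)
  ... | i , j , i<j , eq with iter-repeat⇒period i<j eq
  ... | o , _ , per = o , per

  minimal-period : ∀ x → ∃ λ q → iter σ (suc q) x ≡ x × (∀ r → r < q → iter σ (suc r) x ≢ x)
  minimal-period x with has-period x
  ... | k , per = least-witness (λ r → iter σ (suc r) x Fin.≟ x) {k} per

  period-distinct : ∀ {q x} → (∀ r → r < q → iter σ (suc r) x ≢ x) →
    ∀ {i j} → i < j → j ≤ q → iter σ (suc i) x ≢ iter σ (suc j) x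
  period-distinct minimal {i} i<j j≤q eq with iter-repeat⇒period (s≤s i<j) eq
  ... | o , i+o<j , per = minimal o (<-≤-trans (≤-<-trans (m≤n+m o i) (≤-pred i+o<j)) j≤q) per

  closingPath⇒orbit : ∀ {S x} → PathIn σ S (σ ⟨$⟩ʳ x) x →
    ∃ λ k → iter σ (suc k) x ≡ x × (∀ j → iter σ j x ≡ x ⊎ S (iter σ j x))
  closingPath⇒orbit {S} {x} (k , end , inS , _) = k , per , onOrbit
    where
    per : iter σ (suc k) x ≡ x
    per = trans (sym (iter-suc k x)) end
    onOrbit : ∀ j → iter σ j x ≡ x ⊎ S (iter σ j x)
    onOrbit j with periodic-reduce k per j
    ... | zero  , _   , eq = inj₁ eq
    ... | suc i , i<k , eq = inj₂ (subst S (trans (iter-suc i x) (sym eq)) (inS i i<k))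

  orbit⇒closingPath : ∀ {S x} → (∀ j → iter σ j x ≢ x → S (iter σ j x)) → PathIn σ S (σ ⟨$⟩ʳ x) x
  orbit⇒closingPath {S} {x} onOrbit with minimal-period x
  ... | q , per , minimal = q , trans (iter-suc q x) per , inS , distinct
    where
    inS : ∀ i → i < q → S (iter σ i (σ ⟨$⟩ʳ x))
    inS i i<q = subst S (sym (iter-suc i x)) (onOrbit (suc i) (minimal i i<q))
    distinct : ∀ i j → i ≤ q → j ≤ q → i ≢ j → iter σ i (σ ⟨$⟩ʳ x) ≢ iter σ j (σ ⟨$⟩ʳ x)
    distinct i j i≤q j≤q i≢j rewrite iter-suc i x | iter-suc j x with <-cmp i j
    ... | tri< i<j _ _ = period-distinct minimal i<j j≤q
    ... | tri≈ _ i≡j _ = ⊥-elim (i≢j i≡j)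
    ... | tri> _ _ j<i = period-distinct minimal j<i i≤q ∘ sym

  toℕ-≤∧≢⇒< : ∀ {x y : Fin m} → toℕ x ≤ toℕ y → y ≢ x → toℕ x < toℕ y
  toℕ-≤∧≢⇒< x≤y y≢x = ≤∧≢⇒< x≤y (y≢x ∘ sym ∘ toℕ-injective)

  orbit-minimum⇒valleyMin : ∀ k {x} → iter σ (suc k) x ≡ x → σ ⟨$⟩ʳ x ≢ x →
    (∀ j → toℕ x ≤ toℕ (iter σ j x)) → CycleValleyMin σ x
  orbit-minimum⇒valleyMin k {x} per moves minimum =
    (subst (λ y → toℕ x < toℕ y) (sym σ⁻¹x≡) (toℕ-≤∧≢⇒< (minimum k) kth≢x) ,
     toℕ-≤∧≢⇒< (minimum 1) moves) ,
    minimum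
    where
    σ⁻¹x≡ : σ ⟨$⟩ˡ x ≡ iter σ k x
    σ⁻¹x≡ = trans (cong (σ ⟨$⟩ˡ_) (sym per)) (inverseˡ σ)
    kth≢x : iter σ k x ≢ x
    kth≢x kth≡x = moves (trans (cong (σ ⟨$⟩ʳ_) (sym kth≡x)) per)

module _ {n} {σ : Permutation′ (2 * n)} (dp : IsDPerm n σ) where

  even-descends : ∀ {w} → Even w → toℕ (σ ⟨$⟩ʳ w) ≤ toℕ w
  even-descends {w} (c , ew) = ≤-pred (proj₂ (dp w c) ew)

  module _ {u : Fin (2 * n)} (k : ℕ) (per : iter σ (suc k) u ≡ u)
           (onOrbit : ∀ j → iter σ j u ≡ u ⊎ Before n u (iter σ j u)) where

    even-closer-fixed : Even u → σ ⟨$⟩ʳ u ≡ u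
    even-closer-fixed eu = toℕ-injective (≤-antisym (even-descends eu) u≤σu)
      where
      even-orbit : ∀ j → Even (iter σ j u)
      even-orbit j = [ (λ eq → subst Even (sym eq) eu) , before-even {n = n} {u = u} eu ] (onOrbit j)
      u≤σu : toℕ u ≤ toℕ (σ ⟨$⟩ʳ u)
      u≤σu = periodic-invariant σ (λ z → toℕ z ≤ toℕ (σ ⟨$⟩ʳ u)) k per
               (λ j le → ≤-trans (even-descends (even-orbit j)) le) 1 ≤-refl

    odd-closer-minimum : Odd u → ∀ j → toℕ u ≤ toℕ (iter σ j u)
    odd-closer-minimum ou j = ≮⇒≥ λ below →
      <-irrefl refl (periodic-invariant σ (λ z → toℕ z < toℕ u) k per stays-below j below)
      where
      stays-below : ∀ i → toℕ (iter σ i u) < toℕ u → toℕ (iter σ (suc i) u) < toℕ u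
      stays-below i below with onOrbit i
      ... | inj₁ eq = ⊥-elim (<-irrefl (cong toℕ eq) below)
      ... | inj₂ w≺u with before-odd {n = n} {u = u} ou w≺u
      ... | inj₁ ew    = ≤-<-trans (even-descends ew) below
      ... | inj₂ above = ⊥-elim (<-asym below above)

  closer⇒valleyMin : ∀ u → CycleCloser n σ u → CycleValleyMin σ u
  closer⇒valleyMin u (moves , path) with closingPath⇒orbit σ {Before n u} path | even⊎odd u
  ... | k , per , onOrbit | inj₁ eu = ⊥-elim (moves (even-closer-fixed k per onOrbit eu))
  ... | k , per , onOrbit | inj₂ ou =
    orbit-minimum⇒valleyMin σ k per moves (odd-closer-minimum k per onOrbit ou)

  valleyMin⇒closer : ∀ u → CycleValleyMin σ u → CycleCloser n σ u
  valleyMin⇒closer u ((_ , u<σu) , minimum) with even⊎odd u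
  ... | inj₁ eu = ⊥-elim (<⇒≱ u<σu (even-descends eu))
  ... | inj₂ ou = (λ σu≡u → <-irrefl (cong toℕ (sym σu≡u)) u<σu) ,
                  orbit⇒closingPath σ {Before n u}
                    (λ j moved → above-before-odd {n} {u} ou (toℕ-≤∧≢⇒< σ (minimum j) moved))

lemma7p6 : ∀ (n : ℕ) (σ : Permutation′ (2 * n)) → IsDPerm n σ →
    ∀ (u : Fin (2 * n)) → CycleCloser n σ u ⇔ CycleValleyMin σ u
lemma7p6 n σ dp u = mk⇔ (closer⇒valleyMin {n} {σ} dp u) (valleyMin⇒closer {n} {σ} dp u)
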